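{- Every cograph has a terminal set.
   Context: A cograph is a graph containing no induced path on four vertices ($P_4$). A set $S \subseteq V(G)$ is in general position if no shortest path of $G$ contains three vertices of $S$. A terminal set of $G$ is a general position set $S$ that is maximal under inclusion and such that for every $u \in V(G)\setminus S$ there is a shortest path of $G$ with $u$ as an endpoint containing at least two vertices of $S$. -}

module Defs where

open import Data.Nat using (ℕ; _≤_)
open import Data.Fin using (Fin)
open import Data.Fin.Subset using (Subset; _∈_; _∉_; _⊆_)
open import Data.List using (List; []; _∷_; length)
import Data.List.Membership.Propositional as LM
open import Data.Product using (Σ; ∃; _×_; _,_)
open import Data.Sum using (_⊎_)
open import Data.Empty using (⊥)
open import Relation.Nullary using (¬_; Dec)
open import Relation.Binary.PropositionalEquality using (_≡_; _≢_)

record Graph (n : ℕ) : Set₁ where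
  field
    Adj    : Fin n → Fin n → Set
    sym    : ∀ {u v} → Adj u v → Adj v u
    irrefl : ∀ {u} → ¬ Adj u u
    dec    : ∀ u v → Dec (Adj u v)
open Graph public

module _ {n : ℕ} (G : Graph n) where

  data Walk : Fin n → Fin n → List (Fin n) → Set where
    [_] : ∀ u → Walk u u (u ∷ [])
    _∷_ : ∀ {u w v p} → Adj G u w → Walk w v p → Walk u v (u ∷ p)

  -- A shortest u,v-path: a u,v-walk with the minimum number of vertices
  -- among all u,v-walks (such a walk is automatically a path).
  ShortestPath : Fin n → Fin n → List (Fin n) → Set
  ShortestPath u v p = Walk u v p × (∀ q → Walk u v q → length p ≤ length q)

  GeneralPosition : Subset n → Set
  GeneralPosition S =
    ∀ u v p → ShortestPath u v p →
    ∀ a b c → a ≢ b → a ≢ c → b ≢ c →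
    a ∈ S → b ∈ S → c ∈ S →
    a LM.∈ p → b LM.∈ p → c LM.∈ p → ⊥

  MaximalGP : Subset n → Set
  MaximalGP S = GeneralPosition S × (∀ T → GeneralPosition T → S ⊆ T → T ⊆ S)

  Terminal : Subset n → Set
  Terminal S =
    MaximalGP S ×
    (∀ u → u ∉ S →
      Σ (Fin n) λ v → Σ (List (Fin n)) λ p →
        (ShortestPath u v p ⊎ ShortestPath v u p) ×
        Σ (Fin n) λ a → Σ (Fin n) λ b →
          a ≢ b × a ∈ S × b ∈ S × a LM.∈ p × b LM.∈ p)

  InducedP4 : Set
  InducedP4 =
    Σ (Fin n) λ a → Σ (Fin n) λ b → Σ (Fin n) λ c → Σ (Fin n) λ d →
      a ≢ b × a ≢ c × a ≢ d × b ≢ c × b ≢ d × c ≢ d ×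
      Adj G a b × Adj G b c × Adj G c d ×
      ¬ Adj G a c × ¬ Adj G a d × ¬ Adj G b d

  Cograph : Set
  Cograph = ¬ InducedP4

{-# OPTIONS --safe #-}
module Submission where

open import Defs
open import Data.Nat using (ℕ; _≤_; _<_; z≤n; s≤s)
open import Data.Nat.Properties using (n<1+n; m<n⇒m<1+n; m≤n⇒m≤1+n; <⇒≱)
open import Data.Fin using (Fin; _≟_)
open import Data.Fin.Properties using (any?)
open import Data.Fin.Subset using (Subset; _∈_; _∉_; _⊆_; _∪_; ⁅_⁆) renaming (⊥ to ∅)
open import Data.Fin.Subset.Properties using (_∈?_; ∉⊥; x∈⁅x⁆; x∈⁅y⁆⇒x≡y; p⊆p∪q; q⊆p∪q; x∈p∪q⁻)
open import Data.List using (List; []; _∷_; length; allFin)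
open import Data.List.Membership.Propositional using () renaming (_∈_ to _∈ₗ_)
open import Data.List.Membership.Propositional.Properties using (∈-allFin)
open import Data.List.Relation.Unary.Any using (here; there; tail)
open import Data.List.Relation.Unary.Any.Properties using (reverse⁺)
open import Data.Product using (Σ; ∃; ∃₂; _×_; _,_; proj₁)
open import Data.Sum using (_⊎_; inj₁; inj₂; map₂)
open import Data.Empty using (⊥; ⊥-elim)
open import Function using (_∘_; id)
open import Relation.Nullary using (¬_; Dec; yes; no; contradiction; ¬?; _×-dec_)
open import Relation.Unary using (Decidable)
open import Relation.Binary.PropositionalEquality as ≡ using (_≡_; _≢_; refl)

-- In a P₄-free graph a shortest path has at most three vertices, so a set is
-- in general position as soon as no two of its vertices are at distance
-- exactly two. Take S to be a maximal such set, i.e. a maximal independent set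
-- of the exact-distance-two graph. Every u ∉ S is at distance two from some
-- s ∈ S, through some w; if w ∉ S, then w is at distance two from some s' ∈ S,
-- and P₄-freeness forces a shortest path u, a, b with a, b ∈ S. That path
-- witnesses both the maximality of S and the terminal condition at u.

module _ {a} {A : Set a} where

  two-distinct⇒2≤length : ∀ {x y : A} {xs} → x ≢ y → x ∈ₗ xs → y ∈ₗ xs → 2 ≤ length xs
  two-distinct⇒2≤length x≢y (here refl) (here refl)       = contradiction refl x≢y
  two-distinct⇒2≤length _   (here _)    (there (here _))  = s≤s (s≤s z≤n)
  two-distinct⇒2≤length _   (here _)    (there (there _)) = s≤s (s≤s z≤n)
  two-distinct⇒2≤length _   (there (here _))  (here _)    = s≤s (s≤s z≤n)
  two-distinct⇒2≤length _   (there (there _)) (here _)    = s≤s (s≤s z≤n)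
  two-distinct⇒2≤length x≢y (there x∈) (there y∈) =
    m≤n⇒m≤1+n (two-distinct⇒2≤length x≢y x∈ y∈)

  three-distinct⇒3≤length : ∀ {x y z : A} {xs} → x ≢ y → x ≢ z → y ≢ z →
                            x ∈ₗ xs → y ∈ₗ xs → z ∈ₗ xs → 3 ≤ length xs
  three-distinct⇒3≤length x≢y x≢z y≢z (here refl) y∈ z∈ =
    s≤s (two-distinct⇒2≤length y≢z (tail (x≢y ∘ ≡.sym) y∈) (tail (x≢z ∘ ≡.sym) z∈))
  three-distinct⇒3≤length x≢y x≢z y≢z (there x∈) (here refl) z∈ =
    s≤s (two-distinct⇒2≤length x≢z x∈ (tail (y≢z ∘ ≡.sym) z∈))
  three-distinct⇒3≤length x≢y x≢z y≢z (there x∈) (there y∈) (here refl) =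
    s≤s (two-distinct⇒2≤length x≢y x∈ y∈)
  three-distinct⇒3≤length x≢y x≢z y≢z (there x∈) (there y∈) (there z∈) =
    m≤n⇒m≤1+n (three-distinct⇒3≤length x≢y x≢z y≢z x∈ y∈ z∈)

module _ {a p} {A : Set a} {P : A → Set p} (P? : Decidable P) where

  three-distinct-in-triple⇒head :
    ∀ {x y z u v w} → x ≢ y → x ≢ z → y ≢ z → P x → P y → P z →
    x ∈ₗ (u ∷ v ∷ w ∷ []) → y ∈ₗ (u ∷ v ∷ w ∷ []) → z ∈ₗ (u ∷ v ∷ w ∷ []) → P u
  three-distinct-in-triple⇒head {u = u} x≢y x≢z y≢z px py pz x∈ y∈ z∈ with P? u
  ... | yes pu = pu
  ... | no ¬pu = contradiction
        (three-distinct⇒3≤length x≢y x≢z y≢z (tail (≢u px) x∈) (tail (≢u py) y∈) (tail (≢u pz) z∈))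
        λ { (s≤s (s≤s ())) }
    where
    ≢u : ∀ {t} → P t → t ≢ u
    ≢u pt refl = ¬pu pt

  three-distinct-in-triple⇒ends :
    ∀ {x y z u v w} → x ≢ y → x ≢ z → y ≢ z → P x → P y → P z →
    x ∈ₗ (u ∷ v ∷ w ∷ []) → y ∈ₗ (u ∷ v ∷ w ∷ []) → z ∈ₗ (u ∷ v ∷ w ∷ []) → P u × P w
  three-distinct-in-triple⇒ends x≢y x≢z y≢z px py pz x∈ y∈ z∈ =
      three-distinct-in-triple⇒head x≢y x≢z y≢z px py pz x∈ y∈ z∈
    , three-distinct-in-triple⇒head x≢y x≢z y≢z px py pz (reverse⁺ x∈) (reverse⁺ y∈) (reverse⁺ z∈)

module _ {n : ℕ} (G : Graph n) where

  adj⇒≢ : ∀ {u v} → Adj G u v → u ≢ v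
  adj⇒≢ uv refl = irrefl G uv

  inducedP4 : ∀ {a b c d} → Adj G a b → Adj G b c → Adj G c d →
              ¬ Adj G a c → ¬ Adj G a d → ¬ Adj G b d → InducedP4 G
  inducedP4 {a} {b} {c} {d} ab bc cd ¬ac ¬ad ¬bd =
    _ , _ , _ , _ , adj⇒≢ ab , a≢c , a≢d , adj⇒≢ bc , b≢d , adj⇒≢ cd ,
    ab , bc , cd , ¬ac , ¬ad , ¬bd
    where
    a≢c : a ≢ c
    a≢c refl = ¬ad cd
    a≢d : a ≢ d
    a≢d refl = ¬ac (sym G cd)
    b≢d : b ≢ d
    b≢d refl = ¬ad ab

  CommonNeighbour : Fin n → Fin n → Set
  CommonNeighbour u v = ∃ λ w → Adj G u w × Adj G w v

  AtDistanceTwo : Fin n → Fin n → Set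
  AtDistanceTwo u v = u ≢ v × ¬ Adj G u v × CommonNeighbour u v

  distanceTwoGraph : Graph n
  distanceTwoGraph = record
    { Adj    = AtDistanceTwo
    ; sym    = λ { (u≢v , ¬uv , w , uw , wv) →
                   u≢v ∘ ≡.sym , ¬uv ∘ sym G , w , sym G wv , sym G uw }
    ; irrefl = λ d → proj₁ d refl
    ; dec    = λ u v → ¬? (u ≟ v) ×-dec ¬? (dec G u v) ×-dec
                       any? (λ w → dec G u w ×-dec dec G w v)
    }

  no-shorter-walk : ∀ {u v p q} → ShortestPath G u v p → Walk G u v q → length q < length p → ⊥
  no-shorter-walk (_ , minimal) walk shorter = <⇒≱ shorter (minimal _ walk)

  walk-length≥3 : ∀ {u v q} → u ≢ v → ¬ Adj G u v → Walk G u v q → 3 ≤ length q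
  walk-length≥3 u≢v _   [ _ ]           = contradiction refl u≢v
  walk-length≥3 _   ¬uv (uv ∷ [ _ ])    = contradiction uv ¬uv
  walk-length≥3 _   _   (_ ∷ _ ∷ [ _ ]) = s≤s (s≤s (s≤s z≤n))
  walk-length≥3 _   _   (_ ∷ _ ∷ _ ∷ _) = s≤s (s≤s (s≤s z≤n))

  twoStep-shortestPath : ∀ {u w v} → u ≢ v → ¬ Adj G u v → Adj G u w → Adj G w v →
                         ShortestPath G u v (u ∷ w ∷ v ∷ [])
  twoStep-shortestPath u≢v ¬uv uw wv = (uw ∷ wv ∷ [ _ ]) , λ _ → walk-length≥3 u≢v ¬uv

  twoStep-shortestPath⇒atDistanceTwo : ∀ {u w v} → ShortestPath G u v (u ∷ w ∷ v ∷ []) →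
                                       AtDistanceTwo u v
  twoStep-shortestPath⇒atDistanceTwo {u} {v = v} sp@(uw ∷ wv ∷ [ _ ] , _) = u≢v , ¬uv , _ , uw , wv
    where
    u≢v : u ≢ v
    u≢v refl = no-shorter-walk sp [ _ ] (s≤s (s≤s z≤n))
    ¬uv : ¬ Adj G u v
    ¬uv uv = no-shorter-walk sp (uv ∷ [ _ ]) (n<1+n 2)

  long-shortestPath⇒inducedP4 : ∀ {u x y z v p} → ShortestPath G u v (u ∷ x ∷ y ∷ z ∷ p) →
                                InducedP4 G
  long-shortestPath⇒inducedP4 {u} {x} {y} sp@(ux ∷ xy ∷ _∷_ {w = z} yz rest , _) =
    inducedP4 ux xy yz ¬uy ¬uz ¬xz
    where
    ¬uy : ¬ Adj G u y
    ¬uy uy = no-shorter-walk sp (uy ∷ yz ∷ rest) (n<1+n _)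
    ¬uz : ¬ Adj G u z
    ¬uz uz = no-shorter-walk sp (uz ∷ rest) (m<n⇒m<1+n (n<1+n _))
    ¬xz : ¬ Adj G x z
    ¬xz xz = no-shorter-walk sp (ux ∷ xz ∷ rest) (n<1+n _)

∈-∪⁅⁆⁻ : ∀ {n} {S : Subset n} {v x} → x ∈ S ∪ ⁅ v ⁆ → x ∈ S ⊎ x ≡ v
∈-∪⁅⁆⁻ {S = S} {v} = map₂ (x∈⁅y⁆⇒x≡y v) ∘ x∈p∪q⁻ S ⁅ v ⁆

∉∧∈⇒≢ : ∀ {n} {S : Subset n} {u s} → u ∉ S → s ∈ S → u ≢ s
∉∧∈⇒≢ u∉S s∈S refl = u∉S s∈S

module _ {n : ℕ} (H : Graph n) where

  Independent : Subset n → Set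
  Independent S = ∀ {a b} → a ∈ S → b ∈ S → ¬ Adj H a b

  HasNeighbourIn : Subset n → Fin n → Set
  HasNeighbourIn S v = ∃ λ s → s ∈ S × Adj H v s

  hasNeighbourIn? : ∀ S v → Dec (HasNeighbourIn S v)
  hasNeighbourIn? S v = any? λ s → s ∈? S ×-dec dec H v s

  Covered : Subset n → Fin n → Set
  Covered S v = v ∈ S ⊎ HasNeighbourIn S v

  covered-mono : ∀ {S T v} → S ⊆ T → Covered S v → Covered T v
  covered-mono S⊆T (inj₁ v∈S)            = inj₁ (S⊆T v∈S)
  covered-mono S⊆T (inj₂ (s , s∈S , vs)) = inj₂ (s , S⊆T s∈S , vs)

  independent-∪⁅⁆ : ∀ {S v} → Independent S → ¬ HasNeighbourIn S v → Independent (S ∪ ⁅ v ⁆)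
  independent-∪⁅⁆ indS v⊥S a∈ b∈ with ∈-∪⁅⁆⁻ a∈ | ∈-∪⁅⁆⁻ b∈
  ... | inj₁ a∈S  | inj₁ b∈S  = indS a∈S b∈S
  ... | inj₁ a∈S  | inj₂ refl = λ av → v⊥S (_ , a∈S , sym H av)
  ... | inj₂ refl | inj₁ b∈S  = λ vb → v⊥S (_ , b∈S , vb)
  ... | inj₂ refl | inj₂ refl = irrefl H

  greedyStep : Subset n → Fin n → Subset n
  greedyStep S v with hasNeighbourIn? S v
  ... | yes _ = S
  ... | no _  = S ∪ ⁅ v ⁆

  greedyStep-⊇ : ∀ {S v} → S ⊆ greedyStep S v
  greedyStep-⊇ {S} {v} with hasNeighbourIn? S v
  ... | yes _ = id
  ... | no _  = p⊆p∪q ⁅ v ⁆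

  greedyStep-independent : ∀ {S v} → Independent S → Independent (greedyStep S v)
  greedyStep-independent {S} {v} indS with hasNeighbourIn? S v
  ... | yes _  = indS
  ... | no v⊥S = independent-∪⁅⁆ indS v⊥S

  greedyStep-covered : ∀ {S v} → Covered (greedyStep S v) v
  greedyStep-covered {S} {v} with hasNeighbourIn? S v
  ... | yes v∼S = inj₂ v∼S
  ... | no _    = inj₁ (q⊆p∪q S ⁅ v ⁆ (x∈⁅x⁆ v))

  greedy : Subset n → List (Fin n) → Subset n
  greedy S []       = S
  greedy S (v ∷ vs) = greedy (greedyStep S v) vs

  greedy-⊇ : ∀ {S} vs → S ⊆ greedy S vs
  greedy-⊇ []       = id
  greedy-⊇ (v ∷ vs) = greedy-⊇ vs ∘ greedyStep-⊇

  greedy-independent : ∀ {S} vs → Independent S → Independent (greedy S vs)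
  greedy-independent []       indS = indS
  greedy-independent (v ∷ vs) indS = greedy-independent vs (greedyStep-independent indS)

  greedy-covered : ∀ {S v vs} → v ∈ₗ vs → Covered (greedy S vs) v
  greedy-covered {vs = _ ∷ vs} (here refl) = covered-mono (greedy-⊇ vs) greedyStep-covered
  greedy-covered               (there v∈)  = greedy-covered v∈

  maximalIndependentSet : ∃ λ S → Independent S × ∀ v → Covered S v
  maximalIndependentSet =
    greedy ∅ (allFin n) ,
    greedy-independent (allFin n) (λ a∈∅ → contradiction a∈∅ ∉⊥) ,
    λ v → greedy-covered (∈-allFin v)

module _ {n : ℕ} (G : Graph n) (cograph : Cograph G) {S : Subset n}
         (independent : Independent (distanceTwoGraph G) S)
         (dominating : ∀ v → Covered (distanceTwoGraph G) S v) where

  generalPosition : GeneralPosition G S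
  generalPosition u v p sp@(walk , _) a b c a≢b a≢c b≢c a∈S b∈S c∈S a∈p b∈p c∈p
    with walk | three-distinct⇒3≤length a≢b a≢c b≢c a∈p b∈p c∈p
  ... | [ _ ]               | s≤s ()
  ... | _ ∷ [ _ ]           | s≤s (s≤s ())
  ... | _ ∷ _ ∷ [ _ ]       | _ =
    let u∈S , v∈S = three-distinct-in-triple⇒ends (_∈? S) a≢b a≢c b≢c a∈S b∈S c∈S a∈p b∈p c∈p
    in independent u∈S v∈S (twoStep-shortestPath⇒atDistanceTwo G sp)
  ... | _ ∷ _ ∷ _ ∷ [ _ ]   | _ = cograph (long-shortestPath⇒inducedP4 G sp)
  ... | _ ∷ _ ∷ _ ∷ _ ∷ _   | _ = cograph (long-shortestPath⇒inducedP4 G sp)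

  twoStep-into-S : ∀ {u} → u ∉ S → ∃₂ λ a b → a ∈ S × b ∈ S × Adj G u a × Adj G a b × ¬ Adj G u b
  twoStep-into-S {u} u∉S with dominating u
  ... | inj₁ u∈S = contradiction u∈S u∉S
  ... | inj₂ (s , s∈S , _ , ¬us , w , uw , ws) with dominating w
  ...   | inj₁ w∈S = w , s , w∈S , s∈S , uw , ws , ¬us
  ...   | inj₂ (s′ , s′∈S , _ , ¬ws′ , x , wx , xs′) with dec G s s′ | dec G u s′
  ...     | yes ss′ | yes us′ = s′ , s , s′∈S , s∈S , us′ , sym G ss′ , ¬us
  ...     | yes ss′ | no ¬us′ = ⊥-elim (cograph (inducedP4 G uw ws ss′ ¬us ¬us′ ¬ws′))
  ...     | no ¬ss′ | _       = ⊥-elim (cograph (inducedP4 G (sym G ws) wx xs′ ¬sx ¬ss′ ¬ws′))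
    where
    s≢s′ : s ≢ s′
    s≢s′ refl = ¬ws′ ws
    ¬sx : ¬ Adj G s x
    ¬sx sx = independent s∈S s′∈S (s≢s′ , ¬ss′ , x , sx , xs′)

  shortestPath-into-S : ∀ {u} → u ∉ S →
    ∃₂ λ a b → a ∈ S × b ∈ S × Adj G a b × ShortestPath G u b (u ∷ a ∷ b ∷ [])
  shortestPath-into-S u∉S =
    let a , b , a∈S , b∈S , ua , ab , ¬ub = twoStep-into-S u∉S
    in a , b , a∈S , b∈S , ab , twoStep-shortestPath G (∉∧∈⇒≢ u∉S b∈S) ¬ub ua ab

  maximal : ∀ T → GeneralPosition G T → S ⊆ T → T ⊆ S
  maximal T gpT S⊆T {t} t∈T with t ∈? S
  ... | yes t∈S = t∈S
  ... | no t∉S =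
    let a , b , a∈S , b∈S , ab , sp = shortestPath-into-S t∉S
    in ⊥-elim (gpT t b _ sp t a b (∉∧∈⇒≢ t∉S a∈S) (∉∧∈⇒≢ t∉S b∈S) (adj⇒≢ G ab)
                   t∈T (S⊆T a∈S) (S⊆T b∈S) (here refl) (there (here refl)) (there (there (here refl))))

  terminal : Terminal G S
  terminal = (generalPosition , maximal) , λ u u∉S →
    let a , b , a∈S , b∈S , ab , sp = shortestPath-into-S u∉S
    in b , _ , inj₁ sp , a , b , adj⇒≢ G ab , a∈S , b∈S , there (here refl) , there (there (here refl))

corollary3p5 : (n : ℕ) (G : Graph n) → Cograph G → Σ (Subset n) λ S → Terminal G S
corollary3p5 n G cograph =
  let S , independent , dominating = maximalIndependentSet (distanceTwoGraph G)
  in S , terminal G cograph independent dominating
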